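{- Let $a_0(x),\dots,a_t(x)$ be polynomials with integer coefficients and set $$\mathcal{R}_{n,t}(x;r,s)=\sum_{i=0}^t a_i(x)\mathcal{F}_{n+i}(x;r,s),\qquad \mathcal{L}_t(x,y)=\sum_{i=0}^t a_i(x)y^i.$$ Then for all non-negative integers $n,m,r,s$ and every prime $p$ with $p\nmid m$, $$\sum_{k=1}^{p-1}\frac{\mathcal{R}_{n+k,t}(x;r,s)}{(-m)^k}\equiv(-m)^n\mathcal{L}_t(x,-m)\left(\mathcal{F}_{p-1}(x;r+m,s)-s!\right)\pmod{p\mathbb{Z}_p[x]}.$$
   Context: ${n\brace k}_r$ is the $r$-Stirling number of the second kind (partitions of $\{1,\dots,n\}$ into $k$ nonempty blocks with $1,\dots,r$ in distinct blocks), and $\mathcal{F}_n(x;r,s)=\sum_{k=0}^n {n+r\brace k+r}_r (k+s)!\,x^k$. $\mathbb{Z}_p$ is the ring of $p$-adic integers ($1/(-m)^k\in\mathbb{Z}_p$), and congruence modulo $p\mathbb{Z}_p[x]$ means coefficientwise congruence modulo $p$. -}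

module Defs where

open import Data.Nat as ℕ using (ℕ; zero; suc; _≤ᵇ_; _≡ᵇ_)
open import Data.Nat using (_!)
open import Data.Nat.Divisibility using (_∣_)
open import Data.Integer as ℤ using (ℤ; +_; ∣_∣)
open import Data.Rational as ℚ using (ℚ; 0ℚ; 1ℚ; _+_; _*_; _-_; -_; ↥_; ↧ₙ_; 1/_)
open import Data.Rational.Properties using (_≟_)
open import Data.List using (List; []; _∷_)
open import Data.Bool using (Bool; true; false; if_then_else_; _∧_)
open import Data.Product using (_×_)
open import Relation.Nullary using (¬_; yes; no)
open import Relation.Nullary.Decidable using (does)

-- r-Stirling numbers of the second kind  {n brace k}_r , defined by the
-- standard (Broder) recurrence:
--   for n ≤ r :  {n brace k}_r = [n = r and k = r]
--   for n > r :  {n brace k}_r = {n-1 brace k-1}_r + k {n-1 brace k}_r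
rStirling : ℕ → ℕ → ℕ → ℕ
rStirling r zero k = if (r ≡ᵇ 0) ∧ (k ≡ᵇ 0) then 1 else 0
rStirling r (suc n) k with suc n ≤ᵇ r
... | true  = if (suc n ≡ᵇ r) ∧ (k ≡ᵇ r) then 1 else 0
... | false = prev k ℕ.+ k ℕ.* rStirling r n k
  where
  prev : ℕ → ℕ
  prev zero    = 0
  prev (suc j) = rStirling r n j

ℕtoℚ : ℕ → ℚ
ℕtoℚ n = + n ℚ./ 1

ℤtoℚ : ℤ → ℚ
ℤtoℚ i = i ℚ./ 1

_^ℚ_ : ℚ → ℕ → ℚ
q ^ℚ zero  = 1ℚ
q ^ℚ suc k = q * (q ^ℚ k)

-- total inverse (inv 0 = 0); only ever applied to nonzero arguments here
inv : ℚ → ℚ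
inv q with q ≟ 0ℚ
... | yes _ = 0ℚ
inv q@(ℚ.mkℚ (+ suc n) _ _) | no _ = 1/ q
inv q@(ℚ.mkℚ ℤ.-[1+ n ] _ _) | no _ = 1/ q
inv (ℚ.mkℚ (+ zero) _ _) | no _ = 0ℚ

Σ< : ℕ → (ℕ → ℚ) → ℚ
Σ< zero    f = 0ℚ
Σ< (suc n) f = Σ< n f + f n

-- Polynomials in x with rational coefficients, as coefficient sequences
-- (all polynomials built below have finite support).
Poly : Set
Poly = ℕ → ℚ

_⊕_ : Poly → Poly → Poly
(f ⊕ g) j = f j + g j

_⊖_ : Poly → Poly → Poly
(f ⊖ g) j = f j - g j

_⊛_ : Poly → Poly → Poly
(f ⊛ g) j = Σ< (suc j) (λ i → f i * g (j ℕ.∸ i))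

_·_ : ℚ → Poly → Poly
(c · f) j = c * f j

constP : ℚ → Poly
constP c zero    = c
constP c (suc _) = 0ℚ

0P : Poly
0P _ = 0ℚ

ΣP< : ℕ → (ℕ → Poly) → Poly
ΣP< n f j = Σ< n (λ i → f i j)

intPoly : List ℤ → Poly
intPoly []       _       = 0ℚ
intPoly (c ∷ cs) zero    = ℤtoℚ c
intPoly (c ∷ cs) (suc j) = intPoly cs j

𝓕 : ℕ → ℕ → ℕ → Poly
𝓕 n r s k = if k ≤ᵇ n
              then ℕtoℚ (rStirling r (n ℕ.+ r) (k ℕ.+ r) ℕ.* (k ℕ.+ s) !)
              else 0ℚ

𝓡 : (ℕ → List ℤ) → ℕ → ℕ → ℕ → ℕ → Poly
𝓡 a n t r s = ΣP< (suc t) (λ i → intPoly (a i) ⊛ 𝓕 (n ℕ.+ i) r s)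

𝓛 : (ℕ → List ℤ) → ℕ → ℚ → Poly
𝓛 a t y = ΣP< (suc t) (λ i → (y ^ℚ i) · intPoly (a i))

-- q ∈ p ℤ_p  (for q ∈ ℚ): q = p·u with u a p-adic integer, i.e. in lowest
-- terms p divides the numerator and p does not divide the denominator.
InPℤp : ℕ → ℚ → Set
InPℤp p q = (p ∣ ∣ ↥ q ∣) × ¬ (p ∣ ↧ₙ q)

_≡_[modpℤp_] : Poly → Poly → ℕ → Set
f ≡ g [modpℤp p ] = ∀ j → InPℤp p (f j - g j)

module Submission where

-- Write p = q + 2 and b = -m.  The j-th coefficient of LHS - RHS is (X - b^{p-1}Y)/b^{p-1}
-- for integers X, Y, so by a p-adic criterion it suffices to prove X ≡ b^{p-1}Y (mod p).
-- Since 𝓡 and 𝓛 are bilinear combinations of the a_i and the 𝓕's, this reduces to a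
-- single coefficient of 𝓕:  Σ_{k=1}^{p-1} b^{p-1-k} 𝓕_{N+k}[c] ≡ b^{p-1} bᴺ (𝓕_{p-1}(r+m)[c] - s![c]).
-- The explicit formula  c!·{M+r brace c+r}_r = Δᶜ[(y + r)ᴹ](0)  writes 𝓕_M[c] as (c+s)!/c! times
-- a forward difference, so it is enough to prove, for every integer a = y + r, the geometric congruence
--   Σ_{k=1}^{p-1} b^{p-1-k} a^{N+k} ≡ b^{p-1} bᴺ ((a - b)^{p-1} - 1)   (mod p),
-- which follows from Fermat's little theorem (both sides are ≡ 0 unless a ≡ b).

open import Defs
open import Data.Nat as ℕ using (ℕ; zero; suc; s≤s; z≤n; _∸_; _!; _≤ᵇ_; _≡ᵇ_)
import Data.Nat.Properties as ℕP
import Data.Nat.Divisibility as ℕD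
import Data.Nat.Coprimality as Coprime
open import Data.Nat.Combinatorics using (_C_; nCk+nC[k+1]≡[n+1]C[k+1]; k>n⇒nCk≡0; nCn≡1; nC1≡n)
open import Data.Nat.Primality using (Prime; euclidsLemma; ¬prime[0]; ¬prime[1])
import Data.Nat.Tactic.RingSolver as ℕSolver
open import Data.Integer as ℤ using (ℤ; +_; -[1+_]; +[1+_]; _^_; 0ℤ; 1ℤ)
import Data.Integer.Properties as ℤP
import Data.Integer.Divisibility.Signed as DS
open import Data.Integer.Tactic.RingSolver using (solve-∀)
open import Data.Rational as ℚ using (ℚ; mkℚ; 0ℚ; 1ℚ; ↥_; _/_)
import Data.Rational.Properties as ℚP
import Data.Rational.Unnormalised as ℚᵘ
open import Data.Rational.Solver using (module +-*-Solver)
open import Data.List using (List; []; _∷_)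
open import Data.Bool using (true; false; T; if_then_else_; _∧_)
import Data.Bool.Properties as BoolP
open import Data.Unit using (tt)
open import Data.Empty using (⊥-elim)
open import Data.Sum using (inj₁; inj₂)
open import Data.Product using (_,_)
open import Function.Bundles using (Equivalence)
open import Relation.Nullary using (¬_; yes; no)
open import Relation.Binary.Bundles using (Setoid)
open import Relation.Binary.PropositionalEquality

module OverIntegers where
  open import Data.Integer using (_+_; _*_; _-_; -_; ∣_∣)
  open import Data.Integer.Divisibility.Signed using (_∣_; divides; _∣?_; ∣ᵤ⇒∣; ∣⇒∣ᵤ)

  sumℤ : ℕ → (ℕ → ℤ) → ℤ
  sumℤ zero    f = 0ℤ
  sumℤ (suc n) f = sumℤ n f + f n

  module _ where
    open ≡-Reasoning

    sum-cong : ∀ n {f g : ℕ → ℤ} → (∀ k → k ℕ.< n → f k ≡ g k) → sumℤ n f ≡ sumℤ n g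
    sum-cong zero    eq = refl
    sum-cong (suc n) eq = cong₂ _+_ (sum-cong n (λ k k<n → eq k (ℕP.m<n⇒m<1+n k<n))) (eq n ℕP.≤-refl)

    sum-cong′ : ∀ n {f g : ℕ → ℤ} → (∀ k → f k ≡ g k) → sumℤ n f ≡ sumℤ n g
    sum-cong′ n eq = sum-cong n (λ k _ → eq k)

    sum-+ : ∀ n f g → sumℤ n (λ k → f k + g k) ≡ sumℤ n f + sumℤ n g
    sum-+ zero    f g = refl
    sum-+ (suc n) f g = trans (cong (_+ (f n + g n)) (sum-+ n f g)) (interchange (sumℤ n f) (sumℤ n g) (f n) (g n))
      where interchange : ∀ a b c d → (a + b) + (c + d) ≡ (a + c) + (b + d)
            interchange = solve-∀

    sum-*ˡ : ∀ n c f → sumℤ n (λ k → c * f k) ≡ c * sumℤ n f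
    sum-*ˡ zero    c f = sym (ℤP.*-zeroʳ c)
    sum-*ˡ (suc n) c f = trans (cong (_+ (c * f n)) (sum-*ˡ n c f)) (sym (ℤP.*-distribˡ-+ c (sumℤ n f) (f n)))

    sum-*ʳ : ∀ n f c → sumℤ n (λ k → f k * c) ≡ sumℤ n f * c
    sum-*ʳ n f c = begin
      sumℤ n (λ k → f k * c) ≡⟨ sum-cong′ n (λ k → ℤP.*-comm (f k) c) ⟩
      sumℤ n (λ k → c * f k) ≡⟨ sum-*ˡ n c f ⟩
      c * sumℤ n f           ≡⟨ ℤP.*-comm c (sumℤ n f) ⟩
      sumℤ n f * c           ∎

    sum-neg : ∀ n f → sumℤ n (λ k → - f k) ≡ - sumℤ n f
    sum-neg zero    f = refl
    sum-neg (suc n) f = trans (cong (_+ - f n) (sum-neg n f)) (sym (ℤP.neg-distrib-+ (sumℤ n f) (f n)))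

    sum-- : ∀ n f g → sumℤ n (λ k → f k - g k) ≡ sumℤ n f - sumℤ n g
    sum-- n f g = trans (sum-+ n f (λ k → - g k)) (cong (λ z → sumℤ n f + z) (sum-neg n g))

    sum-const : ∀ n c → sumℤ n (λ _ → c) ≡ + n * c
    sum-const zero    c = sym (ℤP.*-zeroˡ c)
    sum-const (suc n) c = begin
      sumℤ n (λ _ → c) + c ≡⟨ cong (_+ c) (sum-const n c) ⟩
      + n * c + c          ≡⟨ cong (λ z → + n * c + z) (ℤP.*-identityˡ c) ⟨
      + n * c + 1ℤ * c     ≡⟨ ℤP.*-distribʳ-+ c (+ n) 1ℤ ⟨
      (+ n + 1ℤ) * c       ≡⟨ cong (λ z → + z * c) (ℕP.+-comm n 1) ⟩
      + suc n * c          ∎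

    sum-swap : ∀ n m (f : ℕ → ℕ → ℤ) →
               sumℤ n (λ i → sumℤ m (λ j → f i j)) ≡ sumℤ m (λ j → sumℤ n (λ i → f i j))
    sum-swap zero    m f = sym (trans (sum-const m 0ℤ) (ℤP.*-zeroʳ (+ m)))
    sum-swap (suc n) m f = trans (cong (_+ sumℤ m (f n)) (sum-swap n m f))
                                 (sym (sum-+ m (λ j → sumℤ n (λ i → f i j)) (f n)))

    sum-head : ∀ n f → sumℤ (suc n) f ≡ f 0 + sumℤ n (λ k → f (suc k))
    sum-head zero    f = ℤP.+-comm 0ℤ (f 0)
    sum-head (suc n) f = trans (cong (_+ f (suc n)) (sum-head n f))
                               (ℤP.+-assoc (f 0) (sumℤ n (λ k → f (suc k))) (f (suc n)))

    sum-weighted-inside : ∀ K T J (w : ℕ → ℤ) (c : ℕ → ℕ → ℤ) (u : ℕ → ℕ → ℕ → ℤ) →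
      sumℤ K (λ k → w k * sumℤ T (λ i → sumℤ J (λ l → c i l * u k i l)))
        ≡ sumℤ T (λ i → sumℤ J (λ l → c i l * sumℤ K (λ k → w k * u k i l)))
    sum-weighted-inside K T J w c u = begin
      sumℤ K (λ k → w k * sumℤ T (λ i → sumℤ J (λ l → c i l * u k i l)))
        ≡⟨ sum-cong′ K (λ k → trans (sym (sum-*ˡ T (w k) _)) (sum-cong′ T (λ i → sym (sum-*ˡ J (w k) _)))) ⟩
      sumℤ K (λ k → sumℤ T (λ i → sumℤ J (λ l → w k * (c i l * u k i l))))
        ≡⟨ sum-swap K T _ ⟩
      sumℤ T (λ i → sumℤ K (λ k → sumℤ J (λ l → w k * (c i l * u k i l))))
        ≡⟨ sum-cong′ T (λ i → sum-swap K J _) ⟩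
      sumℤ T (λ i → sumℤ J (λ l → sumℤ K (λ k → w k * (c i l * u k i l))))
        ≡⟨ sum-cong′ T (λ i → sum-cong′ J (λ l → trans (sum-cong′ K (λ k → swap (w k) (c i l) (u k i l)))
                                                         (sum-*ˡ K (c i l) (λ k → w k * u k i l)))) ⟩
      sumℤ T (λ i → sumℤ J (λ l → c i l * sumℤ K (λ k → w k * u k i l))) ∎
      where swap : ∀ x y z → x * (y * z) ≡ y * (x * z)
            swap = solve-∀

    sum-of-weighted-sums : ∀ T J (v : ℕ → ℤ) (c : ℕ → ℕ → ℤ) (g : ℕ → ℤ) →
      sumℤ J (λ l → sumℤ T (λ i → v i * c i l) * g l) ≡ sumℤ T (λ i → sumℤ J (λ l → c i l * (v i * g l)))
    sum-of-weighted-sums T J v c g = begin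
      sumℤ J (λ l → sumℤ T (λ i → v i * c i l) * g l)     ≡⟨ sum-cong′ J (λ l → sym (sum-*ʳ T (λ i → v i * c i l) (g l))) ⟩
      sumℤ J (λ l → sumℤ T (λ i → v i * c i l * g l))     ≡⟨ sum-swap J T _ ⟩
      sumℤ T (λ i → sumℤ J (λ l → v i * c i l * g l))     ≡⟨ sum-cong′ T (λ i → sum-cong′ J (λ l → rearrange (v i) (c i l) (g l))) ⟩
      sumℤ T (λ i → sumℤ J (λ l → c i l * (v i * g l)))   ∎
      where rearrange : ∀ v c g → v * c * g ≡ c * (v * g)
            rearrange = solve-∀

  -- Congruence of integers modulo an integer m, as a record so that both sides
  -- can be inferred from the type.
  infix 4 _≡_[mod_]
  record _≡_[mod_] (a b m : ℤ) : Set where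
    constructor mod
    field divides-difference : m ∣ (a - b)
  open _≡_[mod_] public

  module Congruence (m : ℤ) where

    private
      ∣0 : ∀ {a} → a ≡ 0ℤ → m ∣ a
      ∣0 refl = divides 0ℤ refl

    ≡mod-reflexive : ∀ {a b} → a ≡ b → a ≡ b [mod m ]
    ≡mod-reflexive {a} refl = mod (∣0 (ℤP.+-inverseʳ a))

    ≡mod-refl : ∀ {a} → a ≡ a [mod m ]
    ≡mod-refl = ≡mod-reflexive refl

    ≡mod-sym : ∀ {a b} → a ≡ b [mod m ] → b ≡ a [mod m ]
    ≡mod-sym {a} {b} (mod d) = mod (subst (m ∣_) (flip a b) (DS.∣m⇒∣-m d))
      where flip : ∀ a b → - (a - b) ≡ b - a
            flip = solve-∀

    ≡mod-trans : ∀ {a b c} → a ≡ b [mod m ] → b ≡ c [mod m ] → a ≡ c [mod m ]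
    ≡mod-trans {a} {b} {c} (mod d) (mod e) = mod (subst (m ∣_) (chain a b c) (DS.∣m∣n⇒∣m+n d e))
      where chain : ∀ a b c → (a - b) + (b - c) ≡ a - c
            chain = solve-∀

    ≡mod-setoid : Setoid _ _
    ≡mod-setoid = record
      { Carrier       = ℤ
      ; _≈_           = λ a b → a ≡ b [mod m ]
      ; isEquivalence = record { refl = ≡mod-refl ; sym = ≡mod-sym ; trans = ≡mod-trans } }

    +-cong : ∀ {a b c d} → a ≡ c [mod m ] → b ≡ d [mod m ] → a + b ≡ c + d [mod m ]
    +-cong {a} {b} {c} {d} (mod x) (mod y) = mod (subst (m ∣_) (regroup a b c d) (DS.∣m∣n⇒∣m+n x y))
      where regroup : ∀ a b c d → (a - c) + (b - d) ≡ (a + b) - (c + d)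
            regroup = solve-∀

    neg-cong : ∀ {a b} → a ≡ b [mod m ] → - a ≡ - b [mod m ]
    neg-cong {a} {b} (mod x) = mod (subst (m ∣_) (regroup a b) (DS.∣m⇒∣-m x))
      where regroup : ∀ a b → - (a - b) ≡ (- a) - (- b)
            regroup = solve-∀

    sub-cong : ∀ {a b c d} → a ≡ c [mod m ] → b ≡ d [mod m ] → a - b ≡ c - d [mod m ]
    sub-cong x y = +-cong x (neg-cong y)

    *-cong : ∀ {a b c d} → a ≡ c [mod m ] → b ≡ d [mod m ] → a * b ≡ c * d [mod m ]
    *-cong {a} {b} {c} {d} (mod x) (mod y) =
      mod (subst (m ∣_) (regroup a b c d) (DS.∣m∣n⇒∣m+n (DS.∣m⇒∣m*n b x) (DS.∣n⇒∣m*n c y)))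
      where regroup : ∀ a b c d → (a - c) * b + c * (b - d) ≡ a * b - c * d
            regroup = solve-∀

    +-congˡ : ∀ a {b c} → b ≡ c [mod m ] → a + b ≡ a + c [mod m ]
    +-congˡ a = +-cong (≡mod-refl {a})

    +-congʳ : ∀ {a b} c → a ≡ b [mod m ] → a + c ≡ b + c [mod m ]
    +-congʳ c h = +-cong h (≡mod-refl {c})

    sub-congʳ : ∀ {a b} c → a ≡ b [mod m ] → a - c ≡ b - c [mod m ]
    sub-congʳ c h = sub-cong h (≡mod-refl {c})

    *-congˡ : ∀ a {b c} → b ≡ c [mod m ] → a * b ≡ a * c [mod m ]
    *-congˡ a = *-cong (≡mod-refl {a})

    ^-cong : ∀ {a b} n → a ≡ b [mod m ] → a ^ n ≡ b ^ n [mod m ]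
    ^-cong zero    _ = ≡mod-refl
    ^-cong (suc n) x = *-cong x (^-cong n x)

    sum-cong-mod : ∀ n {f g} → (∀ k → k ℕ.< n → f k ≡ g k [mod m ]) → sumℤ n f ≡ sumℤ n g [mod m ]
    sum-cong-mod zero    _ = ≡mod-refl
    sum-cong-mod (suc n) x = +-cong (sum-cong-mod n (λ k k<n → x k (ℕP.m<n⇒m<1+n k<n))) (x n ℕP.≤-refl)

    ∣⇒≡0 : ∀ {a} → m ∣ a → a ≡ 0ℤ [mod m ]
    ∣⇒≡0 {a} d = mod (subst (m ∣_) (sym (ℤP.+-identityʳ a)) d)

    ≡0⇒∣ : ∀ {a} → a ≡ 0ℤ [mod m ] → m ∣ a
    ≡0⇒∣ {a} (mod d) = subst (m ∣_) (ℤP.+-identityʳ a) d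

  absorption : ∀ n k → suc k ℕ.* (suc n C suc k) ≡ suc n ℕ.* (n C k)
  absorption zero    zero    = refl
  absorption zero    (suc k) = begin
    suc (suc k) ℕ.* (1 C suc (suc k)) ≡⟨ cong (suc (suc k) ℕ.*_) (k>n⇒nCk≡0 {1} {suc (suc k)} (s≤s (s≤s z≤n))) ⟩
    suc (suc k) ℕ.* 0                 ≡⟨ ℕP.*-zeroʳ (suc (suc k)) ⟩
    0                                 ≡⟨ cong (1 ℕ.*_) (k>n⇒nCk≡0 {0} {suc k} (s≤s z≤n)) ⟨
    1 ℕ.* (0 C suc k)                 ∎
    where open ≡-Reasoning
  absorption (suc n) zero    = trans (ℕP.*-identityˡ _) (trans (nC1≡n (suc (suc n))) (sym (ℕP.*-identityʳ _)))
  absorption (suc n) (suc k) = begin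
    suc (suc k) ℕ.* (suc (suc n) C suc (suc k))        ≡⟨ cong (suc (suc k) ℕ.*_) (pascal (suc n) (suc k)) ⟨
    suc (suc k) ℕ.* (U ℕ.+ V)                          ≡⟨ regroup₁ k U V ⟩
    suc k ℕ.* U ℕ.+ U ℕ.+ suc (suc k) ℕ.* V            ≡⟨ cong₂ (λ x y → x ℕ.+ U ℕ.+ y) (absorption n k) (absorption n (suc k)) ⟩
    suc n ℕ.* (n C k) ℕ.+ U ℕ.+ suc n ℕ.* (n C suc k)  ≡⟨ regroup₂ n (n C k) U (n C suc k) ⟩
    suc n ℕ.* (n C k ℕ.+ n C suc k) ℕ.+ U              ≡⟨ cong (λ z → suc n ℕ.* z ℕ.+ U) (pascal n k) ⟩
    suc n ℕ.* U ℕ.+ U                                  ≡⟨ ℕP.+-comm (suc n ℕ.* U) U ⟩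
    suc (suc n) ℕ.* U                                  ∎
    where
    open ≡-Reasoning
    pascal = nCk+nC[k+1]≡[n+1]C[k+1]
    U = suc n C suc k
    V = suc n C suc (suc k)
    regroup₁ : ∀ k U V → (2 ℕ.+ k) ℕ.* (U ℕ.+ V) ≡ (1 ℕ.+ k) ℕ.* U ℕ.+ U ℕ.+ (2 ℕ.+ k) ℕ.* V
    regroup₁ = ℕSolver.solve-∀
    regroup₂ : ∀ n a u b → (1 ℕ.+ n) ℕ.* a ℕ.+ u ℕ.+ (1 ℕ.+ n) ℕ.* b ≡ (1 ℕ.+ n) ℕ.* (a ℕ.+ b) ℕ.+ u
    regroup₂ = ℕSolver.solve-∀

  binomial : ∀ x n → (x + 1ℤ) ^ n ≡ sumℤ (suc n) (λ k → + (n C k) * x ^ k)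
  binomial x zero    = refl
  binomial x (suc n) = begin
    (x + 1ℤ) * (x + 1ℤ) ^ n                                  ≡⟨ cong ((x + 1ℤ) *_) (binomial x n) ⟩
    (x + 1ℤ) * sumℤ (suc n) g                                ≡⟨ expand x (sumℤ (suc n) g) ⟩
    x * sumℤ (suc n) g + sumℤ (suc n) g                      ≡⟨ cong₂ _+_ (sym (sum-*ˡ (suc n) x g)) (sum-head n g) ⟩
    sumℤ (suc n) (λ k → x * g k) + (1ℤ + sumℤ n h)           ≡⟨ cong (λ z → sumℤ (suc n) (λ k → x * g k) + (1ℤ + z)) top-vanishes ⟩
    sumℤ (suc n) (λ k → x * g k) + (1ℤ + sumℤ (suc n) h)     ≡⟨ regroup (sumℤ (suc n) (λ k → x * g k)) (sumℤ (suc n) h) ⟩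
    1ℤ + (sumℤ (suc n) (λ k → x * g k) + sumℤ (suc n) h)     ≡⟨ cong (λ z → 1ℤ + z) (sum-+ (suc n) (λ k → x * g k) h) ⟨
    1ℤ + sumℤ (suc n) (λ k → x * g k + h k)                  ≡⟨ cong (λ z → 1ℤ + z) (sum-cong′ (suc n) pascal-term) ⟩
    1ℤ + sumℤ (suc n) (λ k → + (suc n C suc k) * x ^ suc k)  ≡⟨ sum-head (suc n) (λ k → + (suc n C k) * x ^ k) ⟨
    sumℤ (suc (suc n)) (λ k → + (suc n C k) * x ^ k)         ∎
    where
    open ≡-Reasoning
    g h : ℕ → ℤ
    g k = + (n C k) * x ^ k
    h k = + (n C suc k) * x ^ suc k
    expand : ∀ x s → (x + 1ℤ) * s ≡ x * s + s
    expand = solve-∀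
    regroup : ∀ a b → a + (1ℤ + b) ≡ 1ℤ + (a + b)
    regroup = solve-∀
    -- the extra summand C(n, n+1)·xⁿ⁺¹ is zero
    top-vanishes : sumℤ n h ≡ sumℤ (suc n) h
    top-vanishes = begin
      sumℤ n h                                   ≡⟨ ℤP.+-identityʳ (sumℤ n h) ⟨
      sumℤ n h + 0ℤ                              ≡⟨ cong (λ z → sumℤ n h + z) (ℤP.*-zeroˡ (x ^ suc n)) ⟨
      sumℤ n h + 0ℤ * x ^ suc n                  ≡⟨ cong (λ c → sumℤ n h + + c * x ^ suc n) (k>n⇒nCk≡0 {n} {suc n} ℕP.≤-refl) ⟨
      sumℤ (suc n) h                             ∎
    pascal-term : ∀ k → x * g k + h k ≡ + (suc n C suc k) * x ^ suc k
    pascal-term k = begin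
      x * (+ (n C k) * x ^ k) + + (n C suc k) * x ^ suc k    ≡⟨ regroup′ x (+ (n C k)) (+ (n C suc k)) (x ^ k) ⟩
      (+ (n C k) + + (n C suc k)) * x ^ suc k                ≡⟨ cong (_* x ^ suc k) (ℤP.pos-+ (n C k) (n C suc k)) ⟨
      + (n C k ℕ.+ n C suc k) * x ^ suc k                    ≡⟨ cong (λ c → + c * x ^ suc k) (nCk+nC[k+1]≡[n+1]C[k+1] n k) ⟩
      + (suc n C suc k) * x ^ suc k                          ∎
      where regroup′ : ∀ x a b y → x * (a * y) + b * (x * y) ≡ (a + b) * (x * y)
            regroup′ = solve-∀

  horner : ∀ b M (g : ℕ → ℤ) →
           sumℤ (suc (suc M)) (λ k → b ^ (suc M ∸ k) * g k) ≡ b * sumℤ (suc M) (λ k → b ^ (M ∸ k) * g k) + g (suc M)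
  horner b M g = cong₂ _+_ lower-terms top-term
    where
    lower-terms : sumℤ (suc M) (λ k → b ^ (suc M ∸ k) * g k) ≡ b * sumℤ (suc M) (λ k → b ^ (M ∸ k) * g k)
    lower-terms = trans (sum-cong (suc M) (λ k k≤M →
                           trans (cong (λ e → b ^ e * g k) (ℕP.+-∸-assoc 1 (ℕP.≤-pred k≤M)))
                                 (ℤP.*-assoc b (b ^ (M ∸ k)) (g k))))
                        (sum-*ˡ (suc M) b (λ k → b ^ (M ∸ k) * g k))
    top-term : b ^ (suc M ∸ suc M) * g (suc M) ≡ g (suc M)
    top-term = trans (cong (λ e → b ^ e * g (suc M)) (ℕP.n∸n≡0 M)) (ℤP.*-identityˡ (g (suc M)))

  geometric : ℤ → ℤ → ℕ → ℤ
  geometric a b M = sumℤ (suc M) (λ k → b ^ (M ∸ k) * a ^ suc k)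

  telescope : ∀ a b M → (a - b) * geometric a b M ≡ a ^ suc (suc M) - a * b ^ suc M
  telescope a b zero    = base a b
    where base : ∀ a b → (a - b) * (0ℤ + 1ℤ * (a * 1ℤ)) ≡ a * (a * 1ℤ) - a * (b * 1ℤ)
          base = solve-∀
  telescope a b (suc M) = begin
    (a - b) * geometric a b (suc M)             ≡⟨ cong ((a - b) *_) (horner b M (λ k → a ^ suc k)) ⟩
    (a - b) * (b * geometric a b M + X)         ≡⟨ distribute a b (geometric a b M) X ⟩
    b * ((a - b) * geometric a b M) + (a - b) * X ≡⟨ cong (λ z → b * z + (a - b) * X) (telescope a b M) ⟩
    b * (X - a * Y) + (a - b) * X               ≡⟨ collect a b X Y ⟩
    a * X - a * (b * Y)                         ∎
    where
    open ≡-Reasoning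
    X = a ^ suc (suc M)
    Y = b ^ suc M
    distribute : ∀ a b t x → (a - b) * (b * t + x) ≡ b * ((a - b) * t) + (a - b) * x
    distribute = solve-∀
    collect : ∀ a b x y → b * (x - a * y) + (a - b) * x ≡ a * x - a * (b * y)
    collect = solve-∀

  -- Throughout, p = q + 2 is a prime (every prime has this form) and P = p as an integer.
  module ModPrime (q : ℕ) (prime : Prime (suc (suc q))) where

    p : ℕ
    p = suc (suc q)

    P : ℤ
    P = + p

    open Congruence P public
    open import Relation.Binary.Reasoning.Setoid ≡mod-setoid

    euclid : ∀ x y → ¬ (P ∣ x) → P ∣ x * y → P ∣ y
    euclid x y P∤x P∣xy
      with euclidsLemma ∣ x ∣ ∣ y ∣ prime (subst (p ℕD.∣_) (ℤP.abs-* x y) (∣⇒∣ᵤ P∣xy))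
    ... | inj₁ p∣x = ⊥-elim (P∤x (∣ᵤ⇒∣ p∣x))
    ... | inj₂ p∣y = ∣ᵤ⇒∣ p∣y

    *-coprime : ∀ x y → ¬ (P ∣ x) → ¬ (P ∣ y) → ¬ (P ∣ x * y)
    *-coprime x y P∤x P∤y P∣xy = P∤y (euclid x y P∤x P∣xy)

    power-coprime : ∀ x e → ¬ (P ∣ x) → ¬ (P ∣ x ^ e)
    power-coprime x zero    P∤x P∣1 = ℕP.<⇒≱ (ℕ.s≤s (ℕ.s≤s ℕ.z≤n)) (ℕD.∣⇒≤ (∣⇒∣ᵤ P∣1))
    power-coprime x (suc e) P∤x     = *-coprime x (x ^ e) P∤x (power-coprime x e P∤x)

    -- p divides C(p, k) for 0 < k < p, by absorption and Euclid's lemma.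
    p∣binomial : ∀ k → suc k ℕ.< p → p ℕD.∣ (p C suc k)
    p∣binomial k k<p
      with euclidsLemma (suc k) (p C suc k) prime
             (subst (p ℕD.∣_) (sym (absorption (suc q) k)) (ℕD.m∣m*n (suc q C k)))
    ... | inj₂ p∣C   = p∣C
    ... | inj₁ p∣1+k = ⊥-elim (ℕP.<⇒≱ k<p (ℕD.∣⇒≤ p∣1+k))

    freshman : ∀ x → (x + 1ℤ) ^ p ≡ x ^ p + 1ℤ [mod P ]
    freshman x = begin
      (x + 1ℤ) ^ p                                     ≡⟨ binomial x p ⟩
      sumℤ (suc p) f                                   ≡⟨ cong (_+ f p) (sum-head (suc q) f) ⟩
      (1ℤ + sumℤ (suc q) (λ k → f (suc k))) + f p      ≈⟨ +-congʳ (f p) (+-congˡ 1ℤ middle-vanishes) ⟩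
      (1ℤ + 0ℤ) + f p                                  ≡⟨ cong (λ c → 1ℤ + + c * x ^ p) (nCn≡1 p) ⟩
      1ℤ + 1ℤ * x ^ p                                  ≡⟨ commute (x ^ p) ⟩
      x ^ p + 1ℤ                                       ∎
      where
      f : ℕ → ℤ
      f k = + (p C k) * x ^ k
      middle-vanishes : sumℤ (suc q) (λ k → f (suc k)) ≡ 0ℤ [mod P ]
      middle-vanishes = ≡mod-trans
        (sum-cong-mod (suc q) (λ k k<1+q → ∣⇒≡0 (DS.∣m⇒∣m*n {m = + (p C suc k)} (x ^ suc k) (∣ᵤ⇒∣ (p∣binomial k (s≤s k<1+q))))))
        (≡mod-reflexive (trans (sum-const (suc q) 0ℤ) (ℤP.*-zeroʳ (+ suc q))))
      commute : ∀ y → 1ℤ + 1ℤ * y ≡ y + 1ℤ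
      commute = solve-∀

    fermat-up : ∀ a → a ^ p ≡ a [mod P ] → (a + 1ℤ) ^ p ≡ a + 1ℤ [mod P ]
    fermat-up a h = ≡mod-trans (freshman a) (+-congʳ 1ℤ h)

    fermat-down : ∀ a → (a + 1ℤ) ^ p ≡ a + 1ℤ [mod P ] → a ^ p ≡ a [mod P ]
    fermat-down a h = begin
      a ^ p                    ≡⟨ cancel (a ^ p) ⟨
      (a ^ p + 1ℤ) - 1ℤ        ≈⟨ sub-congʳ 1ℤ (≡mod-sym (freshman a)) ⟩
      (a + 1ℤ) ^ p - 1ℤ        ≈⟨ sub-congʳ 1ℤ h ⟩
      (a + 1ℤ) - 1ℤ            ≡⟨ cancel a ⟩
      a                        ∎
      where
      cancel : ∀ a → (a + 1ℤ) - 1ℤ ≡ a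
      cancel = solve-∀

    fermat : ∀ a → a ^ p ≡ a [mod P ]
    fermat (+ zero)     = ≡mod-refl
    fermat (+ suc n)    = subst (λ a → a ^ p ≡ a [mod P ]) (cong +_ (ℕP.+-comm n 1)) (fermat-up (+ n) (fermat (+ n)))
    fermat -[1+ zero ]  = fermat-down -[1+ 0 ] (fermat 0ℤ)
    fermat -[1+ suc n ] = fermat-down -[1+ suc n ] (fermat -[1+ n ])

    fermat-unit : ∀ b → ¬ (P ∣ b) → b ^ suc q ≡ 1ℤ [mod P ]
    fermat-unit b P∤b = mod (euclid b (b ^ suc q - 1ℤ) P∤b
                               (subst (P ∣_) (factor b (b ^ suc q)) (divides-difference (fermat b))))
      where factor : ∀ b y → b * y - b ≡ b * (y - 1ℤ)
            factor = solve-∀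

    -- Both sides are ≡ -b^{p-1+N} when a ≡ b, and ≡ 0 otherwise (Fermat).
    geometric-congruence : ∀ a b N → ¬ (P ∣ b) →
      sumℤ (suc q) (λ k → b ^ (q ∸ k) * a ^ (N ℕ.+ suc k)) ≡ b ^ suc q * b ^ N * ((a - b) ^ suc q - 1ℤ) [mod P ]
    geometric-congruence a b N P∤b with P ∣? (a - b)
    ... | yes P∣a-b = begin
      sumℤ (suc q) (λ k → b ^ (q ∸ k) * a ^ (N ℕ.+ suc k)) ≈⟨ sum-cong-mod (suc q) each-term ⟩
      sumℤ (suc q) (λ _ → c)                               ≡⟨ sum-const (suc q) c ⟩
      + suc q * c                                          ≈⟨ mod (subst (P ∣_) (sym add-one-copy) (DS.∣m⇒∣m*n c DS.∣-refl)) ⟩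
      c * (0ℤ - 1ℤ)                                        ≈⟨ *-congˡ c (sub-congʳ 1ℤ (≡mod-sym power-vanishes)) ⟩
      c * ((a - b) ^ suc q - 1ℤ)                           ∎
      where
      c = b ^ suc q * b ^ N
      a≡b : a ≡ b [mod P ]
      a≡b = mod P∣a-b
      exponents : ∀ k → k ℕ.≤ q → q ∸ k ℕ.+ (N ℕ.+ suc k) ≡ suc q ℕ.+ N
      exponents k k≤q = trans (shuffle (q ∸ k) k N) (cong (λ z → suc z ℕ.+ N) (ℕP.m+[n∸m]≡n k≤q))
        where shuffle : ∀ d k N → d ℕ.+ (N ℕ.+ suc k) ≡ suc (k ℕ.+ d) ℕ.+ N
              shuffle = ℕSolver.solve-∀
      each-term : ∀ k → k ℕ.< suc q → b ^ (q ∸ k) * a ^ (N ℕ.+ suc k) ≡ c [mod P ]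
      each-term k k<1+q = begin
        b ^ (q ∸ k) * a ^ (N ℕ.+ suc k) ≈⟨ *-congˡ (b ^ (q ∸ k)) (^-cong (N ℕ.+ suc k) a≡b) ⟩
        b ^ (q ∸ k) * b ^ (N ℕ.+ suc k) ≡⟨ ℤP.^-distribˡ-+-* b (q ∸ k) (N ℕ.+ suc k) ⟨
        b ^ (q ∸ k ℕ.+ (N ℕ.+ suc k))   ≡⟨ cong (b ^_) (exponents k (ℕP.≤-pred k<1+q)) ⟩
        b ^ (suc q ℕ.+ N)               ≡⟨ ℤP.^-distribˡ-+-* b (suc q) N ⟩
        c                               ∎
      power-vanishes : (a - b) ^ suc q ≡ 0ℤ [mod P ]
      power-vanishes = ∣⇒≡0 (DS.∣m⇒∣m*n ((a - b) ^ q) P∣a-b)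
      add-one-copy : + suc q * c - c * (0ℤ - 1ℤ) ≡ P * c
      add-one-copy = trans (cong (λ n → n * c - c * (0ℤ - 1ℤ)) (ℤP.pos-+ 1 q))
                           (trans (add-one (+ q) c) (cong (_* c) (sym (ℤP.pos-+ 2 q))))
        where add-one : ∀ n c → (1ℤ + n) * c - c * (0ℤ - 1ℤ) ≡ (+ 2 + n) * c
              add-one = solve-∀
    ... | no P∤a-b = begin
      sumℤ (suc q) (λ k → b ^ (q ∸ k) * a ^ (N ℕ.+ suc k)) ≡⟨ factor-out ⟩
      a ^ N * geometric a b q                              ≈⟨ ∣⇒≡0 (euclid (a - b) (a ^ N * geometric a b q) P∤a-b (≡0⇒∣ product-vanishes)) ⟩
      0ℤ                                                   ≡⟨ zero-product (b ^ suc q * b ^ N) ⟨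
      b ^ suc q * b ^ N * (1ℤ - 1ℤ)                        ≈⟨ *-congˡ (b ^ suc q * b ^ N) (sub-congʳ 1ℤ (≡mod-sym (fermat-unit (a - b) P∤a-b))) ⟩
      b ^ suc q * b ^ N * ((a - b) ^ suc q - 1ℤ)           ∎
      where
      zero-product : ∀ x → x * (1ℤ - 1ℤ) ≡ 0ℤ
      zero-product = solve-∀
      factor-out : sumℤ (suc q) (λ k → b ^ (q ∸ k) * a ^ (N ℕ.+ suc k)) ≡ a ^ N * geometric a b q
      factor-out = trans (sum-cong′ (suc q) (λ k → trans (cong (b ^ (q ∸ k) *_) (ℤP.^-distribˡ-+-* a N (suc k)))
                                                        (swap (b ^ (q ∸ k)) (a ^ N) (a ^ suc k))))
                         (sum-*ˡ (suc q) (a ^ N) (λ k → b ^ (q ∸ k) * a ^ suc k))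
        where swap : ∀ x y z → x * (y * z) ≡ y * (x * z)
              swap = solve-∀
      -- (a - b)·aᴺ·geometric = aᴺ(aᵖ - a b^{p-1}) ≡ aᴺ(a - a) = 0
      product-vanishes : (a - b) * (a ^ N * geometric a b q) ≡ 0ℤ [mod P ]
      product-vanishes = begin
        (a - b) * (a ^ N * geometric a b q)       ≡⟨ swap (a - b) (a ^ N) (geometric a b q) ⟩
        a ^ N * ((a - b) * geometric a b q)       ≡⟨ cong (a ^ N *_) (telescope a b q) ⟩
        a ^ N * (a ^ p - a * b ^ suc q)           ≈⟨ *-congˡ (a ^ N) (sub-cong (fermat a) (*-congˡ a (fermat-unit b P∤b))) ⟩
        a ^ N * (a - a * 1ℤ)                      ≡⟨ cancel (a ^ N) a ⟩
        0ℤ                                        ∎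
        where swap : ∀ x y z → x * (y * z) ≡ y * (x * z)
              swap = solve-∀
              cancel : ∀ y a → y * (a - a * 1ℤ) ≡ 0ℤ
              cancel = solve-∀

  Δ^ : ℕ → (ℕ → ℤ) → ℕ → ℤ
  Δ^ zero    f x = f x
  Δ^ (suc c) f x = Δ^ c f (suc x) - Δ^ c f x

  Δ-sum : ∀ c n (w : ℕ → ℤ) (f : ℕ → ℕ → ℤ) x →
          Δ^ c (λ y → sumℤ n (λ k → w k * f k y)) x ≡ sumℤ n (λ k → w k * Δ^ c (f k) x)
  Δ-sum zero    n w f x = refl
  Δ-sum (suc c) n w f x = begin
    Δ^ c F (suc x) - Δ^ c F x                                          ≡⟨ cong₂ _-_ (Δ-sum c n w f (suc x)) (Δ-sum c n w f x) ⟩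
    sumℤ n (λ k → w k * Δ^ c (f k) (suc x)) - sumℤ n (λ k → w k * Δ^ c (f k) x) ≡⟨ sum-- n _ _ ⟨
    sumℤ n (λ k → w k * Δ^ c (f k) (suc x) - w k * Δ^ c (f k) x)       ≡⟨ sum-cong′ n (λ k → factor (w k) (Δ^ c (f k) (suc x)) (Δ^ c (f k) x)) ⟩
    sumℤ n (λ k → w k * Δ^ (suc c) (f k) x)                            ∎
    where
    open ≡-Reasoning
    F = λ y → sumℤ n (λ k → w k * f k y)
    factor : ∀ w u v → w * u - w * v ≡ w * (u - v)
    factor = solve-∀

  Δ-scaled-difference : ∀ c K (f g : ℕ → ℤ) x → Δ^ c (λ y → K * (f y - g y)) x ≡ K * (Δ^ c f x - Δ^ c g x)
  Δ-scaled-difference zero    K f g x = refl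
  Δ-scaled-difference (suc c) K f g x = begin
    Δ^ c F (suc x) - Δ^ c F x                                        ≡⟨ cong₂ _-_ (Δ-scaled-difference c K f g (suc x)) (Δ-scaled-difference c K f g x) ⟩
    K * (Δ^ c f (suc x) - Δ^ c g (suc x)) - K * (Δ^ c f x - Δ^ c g x) ≡⟨ regroup K (Δ^ c f (suc x)) (Δ^ c g (suc x)) (Δ^ c f x) (Δ^ c g x) ⟩
    K * (Δ^ (suc c) f x - Δ^ (suc c) g x)                            ∎
    where
    open ≡-Reasoning
    F = λ y → K * (f y - g y)
    regroup : ∀ K u v u′ v′ → K * (u - v) - K * (u′ - v′) ≡ K * ((u - u′) - (v - v′))
    regroup = solve-∀

  Δ-cong-mod : ∀ m c {f g : ℕ → ℤ} → (∀ y → f y ≡ g y [mod m ]) → ∀ x → Δ^ c f x ≡ Δ^ c g x [mod m ]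
  Δ-cong-mod m zero    f≡g x = f≡g x
  Δ-cong-mod m (suc c) f≡g x = Congruence.sub-cong m (Δ-cong-mod m c f≡g (suc x)) (Δ-cong-mod m c f≡g x)

  Δ-const : ∀ c k x → Δ^ (suc c) (λ _ → k) x ≡ 0ℤ
  Δ-const zero    k x = ℤP.+-inverseʳ k
  Δ-const (suc c) k x = cong₂ _-_ (Δ-const c k (suc x)) (Δ-const c k x)

  shifted-power : ℕ → ℕ → ℕ → ℤ
  shifted-power r M y = (+ (y ℕ.+ r)) ^ M

  Δ-power-step : ∀ r M c x →
    Δ^ (suc c) (shifted-power r (suc M)) x
      ≡ + (x ℕ.+ r) * Δ^ (suc c) (shifted-power r M) x + + suc c * Δ^ c (shifted-power r M) (suc x)
  Δ-power-step r M zero    x = begin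
    + suc (x ℕ.+ r) * g (suc x) - + (x ℕ.+ r) * g x   ≡⟨ cong (λ z → z * g (suc x) - + (x ℕ.+ r) * g x) (ℤP.pos-+ 1 (x ℕ.+ r)) ⟩
    (1ℤ + + (x ℕ.+ r)) * g (suc x) - + (x ℕ.+ r) * g x ≡⟨ regroup (+ (x ℕ.+ r)) (g (suc x)) (g x) ⟩
    + (x ℕ.+ r) * (g (suc x) - g x) + 1ℤ * g (suc x)   ∎
    where
    open ≡-Reasoning
    g = shifted-power r M
    regroup : ∀ a u v → (1ℤ + a) * u - a * v ≡ a * (u - v) + 1ℤ * u
    regroup = solve-∀
  Δ-power-step r M (suc c) x = begin
    Δ^ (suc c) G (suc x) - Δ^ (suc c) G x
      ≡⟨ cong₂ _-_ (Δ-power-step r M c (suc x)) (Δ-power-step r M c x) ⟩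
    (+ suc (x ℕ.+ r) * (W₂ - W₁) + + suc c * W₂) - (A * V + + suc c * W₁)
      ≡⟨ cong₂ (λ y z → (y * (W₂ - W₁) + z * W₂) - (A * V + z * W₁)) (ℤP.pos-+ 1 (x ℕ.+ r)) (ℤP.pos-+ 1 c) ⟩
    ((1ℤ + A) * (W₂ - W₁) + (1ℤ + + c) * W₂) - (A * V + (1ℤ + + c) * W₁)
      ≡⟨ regroup A (+ c) V W₁ W₂ ⟩
    A * ((W₂ - W₁) - V) + (+ 2 + + c) * (W₂ - W₁)
      ≡⟨ cong (λ z → A * ((W₂ - W₁) - V) + z * (W₂ - W₁)) (ℤP.pos-+ 2 c) ⟨
    A * ((W₂ - W₁) - V) + + suc (suc c) * (W₂ - W₁) ∎
    where
    open ≡-Reasoning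
    g = shifted-power r M
    G = shifted-power r (suc M)
    A = + (x ℕ.+ r)
    V = Δ^ (suc c) g x
    W₁ = Δ^ c g (suc x)
    W₂ = Δ^ c g (suc (suc x))
    regroup : ∀ a k v w₁ w₂ → ((1ℤ + a) * (w₂ - w₁) + (1ℤ + k) * w₂) - (a * v + (1ℤ + k) * w₁)
                             ≡ a * ((w₂ - w₁) - v) + (+ 2 + k) * (w₂ - w₁)
    regroup = solve-∀

  ≡ᵇ-true : ∀ n → (n ≡ᵇ n) ≡ true
  ≡ᵇ-true n = Equivalence.to BoolP.T-≡ (ℕP.≡⇒≡ᵇ n n refl)
    where open import Function.Bundles using (Equivalence)

  ≡ᵇ-false : ∀ m n → m ≢ n → (m ≡ᵇ n) ≡ false
  ≡ᵇ-false m n m≢n with m ≡ᵇ n in eq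
  ... | true  = ⊥-elim (m≢n (ℕP.≡ᵇ⇒≡ m n (subst T (sym eq) tt)))
  ... | false = refl

  rStirling-initial : ∀ r n k → suc n ℕ.≤ r → rStirling r (suc n) k ≡ (if (suc n ≡ᵇ r) ∧ (k ≡ᵇ r) then 1 else 0)
  rStirling-initial r n k n<r with suc n ≤ᵇ r in eq
  ... | true  = refl
  ... | false = ⊥-elim (subst T eq (ℕP.≤⇒≤ᵇ n<r))

  rStirling-step₀ : ∀ r n → r ℕ.≤ n → rStirling r (suc n) 0 ≡ 0
  rStirling-step₀ r n r≤n with suc n ≤ᵇ r in eq
  ... | true  = ⊥-elim (ℕP.<⇒≱ (ℕP.≤ᵇ⇒≤ (suc n) r (subst T (sym eq) tt)) r≤n)
  ... | false = refl

  rStirling-step : ∀ r n k → r ℕ.≤ n → rStirling r (suc n) (suc k) ≡ rStirling r n k ℕ.+ suc k ℕ.* rStirling r n (suc k)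
  rStirling-step r n k r≤n with suc n ≤ᵇ r in eq
  ... | true  = ⊥-elim (ℕP.<⇒≱ (ℕP.≤ᵇ⇒≤ (suc n) r (subst T (sym eq) tt)) r≤n)
  ... | false = refl

  -- Fewer than r blocks are impossible when 1, …, r lie in distinct blocks.
  rStirling-few-blocks : ∀ r n j → j ℕ.< r → rStirling r n j ≡ 0
  rStirling-few-blocks (suc r) zero    j       j<r = refl
  rStirling-few-blocks r       (suc n) j       j<r with suc n ℕP.≤? r
  ... | yes n<r = trans (rStirling-initial r n j n<r)
                        (cong (λ b → if b then 1 else 0)
                              (trans (cong ((suc n ≡ᵇ r) ∧_) (≡ᵇ-false j r (ℕP.<⇒≢ j<r))) (BoolP.∧-zeroʳ _)))
  ... | no n≮r with ℕP.≤-pred (ℕP.≰⇒> n≮r) | j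
  ...   | r≤n | zero  = rStirling-step₀ r n r≤n
  ...   | r≤n | suc i = trans (rStirling-step r n i r≤n)
                              (cong₂ ℕ._+_ (rStirling-few-blocks r n i (ℕP.<-trans (ℕP.n<1+n i) j<r))
                                           (trans (cong (suc i ℕ.*_) (rStirling-few-blocks r n (suc i) j<r)) (ℕP.*-zeroʳ (suc i))))

  stirling : ℕ → ℕ → ℕ → ℕ
  stirling r M c = rStirling r (M ℕ.+ r) (c ℕ.+ r)

  stirling-0-0 : ∀ r → stirling r 0 0 ≡ 1
  stirling-0-0 zero    = refl
  stirling-0-0 (suc r) = trans (rStirling-initial (suc r) r (suc r) ℕP.≤-refl)
                               (cong (λ b → if b then 1 else 0) (cong₂ _∧_ (≡ᵇ-true r) (≡ᵇ-true r)))

  stirling-0-suc : ∀ r c → stirling r 0 (suc c) ≡ 0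
  stirling-0-suc zero    c = refl
  stirling-0-suc (suc r) c = trans (rStirling-initial (suc r) r (suc c ℕ.+ suc r) ℕP.≤-refl)
    (cong (λ b → if b then 1 else 0)
          (trans (cong ((r ≡ᵇ r) ∧_) (≡ᵇ-false (suc c ℕ.+ suc r) (suc r) (ℕP.>⇒≢ (ℕP.m<n+m (suc r) {suc c} ℕ.z<s)))) (BoolP.∧-zeroʳ _)))

  stirling-suc-0 : ∀ r M → stirling r (suc M) 0 ≡ r ℕ.* stirling r M 0
  stirling-suc-0 zero    M = rStirling-step₀ 0 (M ℕ.+ 0) z≤n
  stirling-suc-0 (suc r) M =
    trans (rStirling-step (suc r) (M ℕ.+ suc r) r (ℕP.m≤n+m (suc r) M))
          (cong (ℕ._+ suc r ℕ.* stirling (suc r) M 0) (rStirling-few-blocks (suc r) (M ℕ.+ suc r) r ℕP.≤-refl))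

  stirling-suc-suc : ∀ r M c → stirling r (suc M) (suc c) ≡ stirling r M c ℕ.+ (suc c ℕ.+ r) ℕ.* stirling r M (suc c)
  stirling-suc-suc r M c = rStirling-step r (M ℕ.+ r) (c ℕ.+ r) (ℕP.m≤n+m r M)

  stirling-vanishes : ∀ r M c → M ℕ.< c → stirling r M c ≡ 0
  stirling-vanishes r zero    (suc c) _         = stirling-0-suc r c
  stirling-vanishes r (suc M) (suc c) (s≤s M<c) = trans (stirling-suc-suc r M c)
    (cong₂ ℕ._+_ (stirling-vanishes r M c M<c)
                 (trans (cong ((suc c ℕ.+ r) ℕ.*_) (stirling-vanishes r M (suc c) (ℕP.m<n⇒m<1+n M<c)))
                        (ℕP.*-zeroʳ (suc c ℕ.+ r))))

  stirling-explicit : ∀ r M c → + (stirling r M c ℕ.* c !) ≡ Δ^ c (shifted-power r M) 0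
  stirling-explicit r zero    zero    = cong (λ z → + (z ℕ.* 1)) (stirling-0-0 r)
  stirling-explicit r zero    (suc c) = trans (cong (λ z → + (z ℕ.* suc c !)) (stirling-0-suc r c))
                                              (sym (Δ-const c 1ℤ 0))
  stirling-explicit r (suc M) zero    = begin
    + (stirling r (suc M) 0 ℕ.* 1)   ≡⟨ cong (λ z → + (z ℕ.* 1)) (stirling-suc-0 r M) ⟩
    + (r ℕ.* stirling r M 0 ℕ.* 1)   ≡⟨ cong +_ (ℕP.*-assoc r (stirling r M 0) 1) ⟩
    + (r ℕ.* (stirling r M 0 ℕ.* 1)) ≡⟨ ℤP.pos-* r _ ⟩
    + r * + (stirling r M 0 ℕ.* 1)   ≡⟨ cong (+ r *_) (stirling-explicit r M 0) ⟩
    + r * shifted-power r M 0        ∎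
    where open ≡-Reasoning
  stirling-explicit r (suc M) (suc c) = begin
    + (stirling r (suc M) (suc c) ℕ.* suc c !)
      ≡⟨ cong (λ z → + (z ℕ.* suc c !)) (stirling-suc-suc r M c) ⟩
    + ((Y ℕ.+ (suc c ℕ.+ r) ℕ.* X) ℕ.* (suc c ℕ.* c !))
      ≡⟨ cong +_ (regroup Y c r X (c !)) ⟩
    + (r ℕ.* (X ℕ.* suc c !) ℕ.+ suc c ℕ.* (X ℕ.* suc c ! ℕ.+ Y ℕ.* c !))
      ≡⟨ embed r (X ℕ.* suc c !) (suc c) (X ℕ.* suc c !) (Y ℕ.* c !) ⟩
    + r * + (X ℕ.* suc c !) + + suc c * (+ (X ℕ.* suc c !) + + (Y ℕ.* c !))
      ≡⟨ cong₂ (λ u v → + r * u + + suc c * (u + v)) (stirling-explicit r M (suc c)) (stirling-explicit r M c) ⟩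
    + r * Δ^ (suc c) g 0 + + suc c * (Δ^ (suc c) g 0 + Δ^ c g 0)
      ≡⟨ cong (λ z → + r * Δ^ (suc c) g 0 + + suc c * z) (difference-plus (Δ^ c g 1) (Δ^ c g 0)) ⟩
    + r * Δ^ (suc c) g 0 + + suc c * Δ^ c g 1
      ≡⟨ Δ-power-step r M c 0 ⟨
    Δ^ (suc c) (shifted-power r (suc M)) 0 ∎
    where
    open ≡-Reasoning
    g = shifted-power r M
    X = stirling r M (suc c)
    Y = stirling r M c
    regroup : ∀ Y c r X f → (Y ℕ.+ (suc c ℕ.+ r) ℕ.* X) ℕ.* (suc c ℕ.* f)
              ≡ r ℕ.* (X ℕ.* (suc c ℕ.* f)) ℕ.+ suc c ℕ.* (X ℕ.* (suc c ℕ.* f) ℕ.+ Y ℕ.* f)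
    regroup = ℕSolver.solve-∀
    embed : ∀ r a n b d → + (r ℕ.* a ℕ.+ n ℕ.* (b ℕ.+ d)) ≡ + r * + a + + n * (+ b + + d)
    embed r a n b d = trans (ℤP.pos-+ (r ℕ.* a) (n ℕ.* (b ℕ.+ d)))
                          (cong₂ _+_ (ℤP.pos-* r a) (trans (ℤP.pos-* n (b ℕ.+ d)) (cong (+ n *_) (ℤP.pos-+ b d))))
    difference-plus : ∀ u v → (u - v) + v ≡ u
    difference-plus = solve-∀

  rising : ℕ → ℕ → ℕ
  rising zero    c = 1
  rising (suc s) c = (c ℕ.+ suc s) ℕ.* rising s c

  factorial-split : ∀ s c → (c ℕ.+ s) ! ≡ c ! ℕ.* rising s c
  factorial-split zero    c = trans (cong _! (ℕP.+-identityʳ c)) (sym (ℕP.*-identityʳ (c !)))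
  factorial-split (suc s) c = begin
    (c ℕ.+ suc s) !                         ≡⟨ cong _! (ℕP.+-suc c s) ⟩
    suc (c ℕ.+ s) ℕ.* (c ℕ.+ s) !           ≡⟨ cong (suc (c ℕ.+ s) ℕ.*_) (factorial-split s c) ⟩
    suc (c ℕ.+ s) ℕ.* (c ! ℕ.* rising s c)  ≡⟨ cong (λ z → z ℕ.* (c ! ℕ.* rising s c)) (ℕP.+-suc c s) ⟨
    (c ℕ.+ suc s) ℕ.* (c ! ℕ.* rising s c)  ≡⟨ swap (c ℕ.+ suc s) (c !) (rising s c) ⟩
    c ! ℕ.* ((c ℕ.+ suc s) ℕ.* rising s c)  ∎
    where
    open ≡-Reasoning
    swap : ∀ a b d → a ℕ.* (b ℕ.* d) ≡ b ℕ.* (a ℕ.* d)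
    swap = ℕSolver.solve-∀

  𝓕-coeff : ℕ → ℕ → ℕ → ℕ → ℤ
  𝓕-coeff N r s c = + (stirling r N c ℕ.* (c ℕ.+ s) !)

  const-coeff : ℕ → ℕ → ℤ
  const-coeff s zero    = + (s !)
  const-coeff s (suc c) = 0ℤ

  𝓕-coeff-as-difference : ∀ N r s c → 𝓕-coeff N r s c ≡ + rising s c * Δ^ c (shifted-power r N) 0
  𝓕-coeff-as-difference N r s c = begin
    + (stirling r N c ℕ.* (c ℕ.+ s) !)               ≡⟨ cong (λ z → + (stirling r N c ℕ.* z)) (factorial-split s c) ⟩
    + (stirling r N c ℕ.* (c ! ℕ.* rising s c))      ≡⟨ cong +_ (rotate (stirling r N c) (c !) (rising s c)) ⟩
    + (rising s c ℕ.* (stirling r N c ℕ.* c !))      ≡⟨ ℤP.pos-* (rising s c) _ ⟩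
    + rising s c * + (stirling r N c ℕ.* c !)        ≡⟨ cong (+ rising s c *_) (stirling-explicit r N c) ⟩
    + rising s c * Δ^ c (shifted-power r N) 0        ∎
    where
    open ≡-Reasoning
    rotate : ∀ a b d → a ℕ.* (b ℕ.* d) ≡ d ℕ.* (a ℕ.* b)
    rotate = ℕSolver.solve-∀

  const-coeff-as-difference : ∀ s c → const-coeff s c ≡ + rising s c * Δ^ c (λ _ → 1ℤ) 0
  const-coeff-as-difference s zero    = trans (cong +_ (trans (factorial-split s 0) (ℕP.*-identityˡ (rising s 0))))
                                              (sym (ℤP.*-identityʳ (+ rising s 0)))
  const-coeff-as-difference s (suc c) = sym (trans (cong (+ rising s (suc c) *_) (Δ-const c 1ℤ 0))
                                                   (ℤP.*-zeroʳ (+ rising s (suc c))))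

  coeffℤ : List ℤ → ℕ → ℤ
  coeffℤ []       _       = 0ℤ
  coeffℤ (c ∷ cs) zero    = c
  coeffℤ (c ∷ cs) (suc l) = coeffℤ cs l

  𝓡-coeff : (ℕ → List ℤ) → ℕ → ℕ → ℕ → ℕ → ℕ → ℤ
  𝓡-coeff a N t r s j = sumℤ (suc t) (λ i → sumℤ (suc j) (λ l → coeffℤ (a i) l * 𝓕-coeff (N ℕ.+ i) r s (j ∸ l)))

  𝓛-coeff : (ℕ → List ℤ) → ℕ → ℤ → ℕ → ℤ
  𝓛-coeff a t y l = sumℤ (suc t) (λ i → y ^ i * coeffℤ (a i) l)

  shift-by-neg : ∀ y r m → + (y ℕ.+ r) - - (+ m) ≡ + (y ℕ.+ (r ℕ.+ m))
  shift-by-neg y r m = begin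
    + (y ℕ.+ r) - - (+ m)    ≡⟨ cong (λ z → + (y ℕ.+ r) + z) (ℤP.neg-involutive (+ m)) ⟩
    + (y ℕ.+ r) + + m        ≡⟨ ℤP.pos-+ (y ℕ.+ r) m ⟨
    + (y ℕ.+ r ℕ.+ m)        ≡⟨ cong +_ (ℕP.+-assoc y r m) ⟩
    + (y ℕ.+ (r ℕ.+ m))      ∎
    where open ≡-Reasoning

  module CoefficientCongruence (q : ℕ) (prime : Prime (suc (suc q))) (m : ℕ) where
    open ModPrime q prime
    open import Relation.Binary.Reasoning.Setoid ≡mod-setoid

    b : ℤ
    b = - (+ m)

    coprime-neg : ¬ (p ℕD.∣ m) → ¬ (P ∣ b)
    coprime-neg p∤m P∣b = p∤m (subst (p ℕD.∣_) (ℤP.∣-i∣≡∣i∣ (+ m)) (∣⇒∣ᵤ P∣b))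

    -- The geometric congruence, with a = y + r, survives taking forward differences in y.
    difference-congruence : ¬ (P ∣ b) → ∀ r N c x →
      sumℤ (suc q) (λ k → b ^ (q ∸ k) * Δ^ c (shifted-power r (N ℕ.+ suc k)) x)
        ≡ b ^ suc q * b ^ N * (Δ^ c (shifted-power (r ℕ.+ m) (suc q)) x - Δ^ c (λ _ → 1ℤ) x) [mod P ]
    difference-congruence P∤b r N c x = begin
      sumℤ (suc q) (λ k → b ^ (q ∸ k) * Δ^ c (f k) x)          ≡⟨ Δ-sum c (suc q) (λ k → b ^ (q ∸ k)) f x ⟨
      Δ^ c (λ y → sumℤ (suc q) (λ k → b ^ (q ∸ k) * f k y)) x   ≈⟨ Δ-cong-mod P c pointwise x ⟩
      Δ^ c (λ y → K * (shifted-power (r ℕ.+ m) (suc q) y - 1ℤ)) x ≡⟨ Δ-scaled-difference c K _ (λ _ → 1ℤ) x ⟩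
      K * (Δ^ c (shifted-power (r ℕ.+ m) (suc q)) x - Δ^ c (λ _ → 1ℤ) x) ∎
      where
      f : ℕ → ℕ → ℤ
      f k = shifted-power r (N ℕ.+ suc k)
      K = b ^ suc q * b ^ N
      pointwise : ∀ y → sumℤ (suc q) (λ k → b ^ (q ∸ k) * f k y) ≡ K * (shifted-power (r ℕ.+ m) (suc q) y - 1ℤ) [mod P ]
      pointwise y = subst (λ a → sumℤ (suc q) (λ k → b ^ (q ∸ k) * f k y) ≡ K * (a ^ suc q - 1ℤ) [mod P ])
                          (shift-by-neg y r m) (geometric-congruence (+ (y ℕ.+ r)) b N P∤b)

    𝓖-coeff : ℕ → ℕ → ℕ → ℤ
    𝓖-coeff r s c = 𝓕-coeff (suc q) (r ℕ.+ m) s c - const-coeff s c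

    -- Multiplying by the rising product turns differences into coefficients of 𝓕 and of s!.
    coefficient-congruence : ¬ (P ∣ b) → ∀ r s N c →
      sumℤ (suc q) (λ k → b ^ (q ∸ k) * 𝓕-coeff (N ℕ.+ suc k) r s c)
        ≡ b ^ suc q * b ^ N * 𝓖-coeff r s c [mod P ]
    coefficient-congruence P∤b r s N c = begin
      sumℤ (suc q) (λ k → b ^ (q ∸ k) * 𝓕-coeff (N ℕ.+ suc k) r s c)
        ≡⟨ sum-cong′ (suc q) (λ k → cong (b ^ (q ∸ k) *_) (𝓕-coeff-as-difference (N ℕ.+ suc k) r s c)) ⟩
      sumℤ (suc q) (λ k → b ^ (q ∸ k) * (ρ * Δ^ c (f k) 0))
        ≡⟨ sum-cong′ (suc q) (λ k → swap (b ^ (q ∸ k)) ρ (Δ^ c (f k) 0)) ⟩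
      sumℤ (suc q) (λ k → ρ * (b ^ (q ∸ k) * Δ^ c (f k) 0))
        ≡⟨ sum-*ˡ (suc q) ρ (λ k → b ^ (q ∸ k) * Δ^ c (f k) 0) ⟩
      ρ * sumℤ (suc q) (λ k → b ^ (q ∸ k) * Δ^ c (f k) 0)
        ≈⟨ *-congˡ ρ (difference-congruence P∤b r N c 0) ⟩
      ρ * (K * (Δ^ c (shifted-power (r ℕ.+ m) (suc q)) 0 - Δ^ c (λ _ → 1ℤ) 0))
        ≡⟨ distribute ρ K (Δ^ c (shifted-power (r ℕ.+ m) (suc q)) 0) (Δ^ c (λ _ → 1ℤ) 0) ⟩
      K * (ρ * Δ^ c (shifted-power (r ℕ.+ m) (suc q)) 0 - ρ * Δ^ c (λ _ → 1ℤ) 0)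
        ≡⟨ cong (K *_) (cong₂ _-_ (sym (𝓕-coeff-as-difference (suc q) (r ℕ.+ m) s c))
                                  (sym (const-coeff-as-difference s c))) ⟩
      K * (𝓕-coeff (suc q) (r ℕ.+ m) s c - const-coeff s c) ∎
      where
      ρ = + rising s c
      K = b ^ suc q * b ^ N
      f : ℕ → ℕ → ℤ
      f k = shifted-power r (N ℕ.+ suc k)
      swap : ∀ x y z → x * (y * z) ≡ y * (x * z)
      swap = solve-∀
      distribute : ∀ ρ K u v → ρ * (K * (u - v)) ≡ K * (ρ * u - ρ * v)
      distribute = solve-∀

    main-congruence : ¬ (P ∣ b) → ∀ a t n r s j →
      sumℤ (suc q) (λ k → b ^ (q ∸ k) * 𝓡-coeff a (n ℕ.+ suc k) t r s j)
        ≡ b ^ suc q * (b ^ n * sumℤ (suc j) (λ l → 𝓛-coeff a t b l * 𝓖-coeff r s (j ∸ l))) [mod P ]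
    main-congruence P∤b a t n r s j = begin
      sumℤ (suc q) (λ k → b ^ (q ∸ k) * 𝓡-coeff a (n ℕ.+ suc k) t r s j)
        ≡⟨ sum-weighted-inside (suc q) (suc t) (suc j) (λ k → b ^ (q ∸ k)) α (λ k i l → 𝓕-coeff (n ℕ.+ suc k ℕ.+ i) r s (j ∸ l)) ⟩
      sumℤ (suc t) (λ i → sumℤ (suc j) (λ l → α i l * sumℤ (suc q) (λ k → b ^ (q ∸ k) * 𝓕-coeff (n ℕ.+ suc k ℕ.+ i) r s (j ∸ l))))
        ≡⟨ sum-cong′ (suc t) (λ i → sum-cong′ (suc j) (λ l → cong (α i l *_) (sum-cong′ (suc q) (λ k →
             cong (λ N → b ^ (q ∸ k) * 𝓕-coeff N r s (j ∸ l)) (reindex n k i))))) ⟩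
      sumℤ (suc t) (λ i → sumℤ (suc j) (λ l → α i l * sumℤ (suc q) (λ k → b ^ (q ∸ k) * 𝓕-coeff (n ℕ.+ i ℕ.+ suc k) r s (j ∸ l))))
        ≈⟨ sum-cong-mod (suc t) (λ i _ → sum-cong-mod (suc j) (λ l _ → *-congˡ (α i l) (coefficient-congruence P∤b r s (n ℕ.+ i) (j ∸ l)))) ⟩
      sumℤ (suc t) (λ i → sumℤ (suc j) (λ l → α i l * (b ^ suc q * b ^ (n ℕ.+ i) * 𝓖 l)))
        ≡⟨ sum-cong′ (suc t) (λ i → sum-cong′ (suc j) (λ l → cong (α i l *_) (split-power i (𝓖 l)))) ⟩
      sumℤ (suc t) (λ i → sumℤ (suc j) (λ l → α i l * (b ^ i * (K * 𝓖 l))))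
        ≡⟨ sum-of-weighted-sums (suc t) (suc j) (b ^_) α (λ l → K * 𝓖 l) ⟨
      sumℤ (suc j) (λ l → 𝓛-coeff a t b l * (K * 𝓖 l))
        ≡⟨ sum-cong′ (suc j) (λ l → swap (𝓛-coeff a t b l) K (𝓖 l)) ⟩
      sumℤ (suc j) (λ l → K * (𝓛-coeff a t b l * 𝓖 l))
        ≡⟨ sum-*ˡ (suc j) K (λ l → 𝓛-coeff a t b l * 𝓖 l) ⟩
      K * sumℤ (suc j) (λ l → 𝓛-coeff a t b l * 𝓖 l)
        ≡⟨ ℤP.*-assoc (b ^ suc q) (b ^ n) _ ⟩
      b ^ suc q * (b ^ n * sumℤ (suc j) (λ l → 𝓛-coeff a t b l * 𝓖 l)) ∎
      where
      α : ℕ → ℕ → ℤ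
      α i l = coeffℤ (a i) l
      𝓖 : ℕ → ℤ
      𝓖 l = 𝓖-coeff r s (j ∸ l)
      K = b ^ suc q * b ^ n
      reindex : ∀ n k i → n ℕ.+ suc k ℕ.+ i ≡ n ℕ.+ i ℕ.+ suc k
      reindex = ℕSolver.solve-∀
      split-power : ∀ i g → b ^ suc q * b ^ (n ℕ.+ i) * g ≡ b ^ i * (K * g)
      split-power i g = trans (cong (λ z → b ^ suc q * z * g) (ℤP.^-distribˡ-+-* b n i))
                              (regroup (b ^ suc q) (b ^ n) (b ^ i) g)
        where regroup : ∀ x y z g → x * (y * z) * g ≡ z * (x * y * g)
              regroup = solve-∀
      swap : ∀ x y z → x * (y * z) ≡ y * (x * z)
      swap = solve-∀

open OverIntegers

module OverRationals where
  open import Data.Rational using (_+_; _*_; _-_)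
  open import Data.Integer.Divisibility.Signed using (∣ᵤ⇒∣; ∣⇒∣ᵤ)

  -- The embedding ℤ → ℚ is a ring homomorphism; we compute with the normal form mkℚ i 0.
  private
    normal : ℤ → ℚ
    normal i = mkℚ i 0 (Coprime.sym (Coprime.1-coprimeTo ℤ.∣ i ∣))

    ℤtoℚ≡normal : ∀ i → ℤtoℚ i ≡ normal i
    ℤtoℚ≡normal i = ℚP.↥p/↧p≡p (normal i)

  ℤtoℚ-+ : ∀ i j → ℤtoℚ (i ℤ.+ j) ≡ ℤtoℚ i + ℤtoℚ j
  ℤtoℚ-+ i j rewrite ℤtoℚ≡normal i | ℤtoℚ≡normal j = cong (_/ 1) (unit-denominators i j)
    where unit-denominators : ∀ i j → i ℤ.+ j ≡ i ℤ.* 1ℤ ℤ.+ j ℤ.* 1ℤ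
          unit-denominators = solve-∀

  ℤtoℚ-* : ∀ i j → ℤtoℚ (i ℤ.* j) ≡ ℤtoℚ i * ℤtoℚ j
  ℤtoℚ-* i j rewrite ℤtoℚ≡normal i | ℤtoℚ≡normal j = refl

  ℤtoℚ-neg : ∀ i → ℤtoℚ (ℤ.- i) ≡ ℚ.- ℤtoℚ i
  ℤtoℚ-neg i rewrite ℤtoℚ≡normal i | ℤtoℚ≡normal (ℤ.- i) = normal-neg i
    where normal-neg : ∀ i → normal (ℤ.- i) ≡ ℚ.- normal i
          normal-neg (+ zero)  = refl
          normal-neg +[1+ n ]  = refl
          normal-neg -[1+ n ]  = refl

  ℤtoℚ-- : ∀ i j → ℤtoℚ (i ℤ.- j) ≡ ℤtoℚ i - ℤtoℚ j
  ℤtoℚ-- i j = trans (ℤtoℚ-+ i (ℤ.- j)) (cong (λ z → ℤtoℚ i + z) (ℤtoℚ-neg j))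

  ℤtoℚ-^ : ∀ i e → ℤtoℚ i ^ℚ e ≡ ℤtoℚ (i ℤ.^ e)
  ℤtoℚ-^ i zero    = refl
  ℤtoℚ-^ i (suc e) = trans (cong (ℤtoℚ i *_) (ℤtoℚ-^ i e)) (sym (ℤtoℚ-* i (i ℤ.^ e)))

  ℤtoℚ-sum : ∀ n (f : ℕ → ℤ) → Σ< n (λ k → ℤtoℚ (f k)) ≡ ℤtoℚ (sumℤ n f)
  ℤtoℚ-sum zero    f = refl
  ℤtoℚ-sum (suc n) f = trans (cong (_+ ℤtoℚ (f n)) (ℤtoℚ-sum n f)) (sym (ℤtoℚ-+ (sumℤ n f) (f n)))

  ℤtoℚ-nonzero : ∀ i → i ≢ 0ℤ → ℤtoℚ i ≢ 0ℚ
  ℤtoℚ-nonzero i i≢0 eq = i≢0 (cong ↥_ (trans (sym (ℤtoℚ≡normal i)) eq))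

  Σ<-cong : ∀ n {f g : ℕ → ℚ} → (∀ k → k ℕ.< n → f k ≡ g k) → Σ< n f ≡ Σ< n g
  Σ<-cong zero    eq = refl
  Σ<-cong (suc n) eq = cong₂ _+_ (Σ<-cong n (λ k k<n → eq k (ℕP.m<n⇒m<1+n k<n))) (eq n ℕP.≤-refl)

  Σ<-cong′ : ∀ n {f g : ℕ → ℚ} → (∀ k → f k ≡ g k) → Σ< n f ≡ Σ< n g
  Σ<-cong′ n eq = Σ<-cong n (λ k _ → eq k)

  Σ<-*ˡ : ∀ n c f → Σ< n (λ k → c * f k) ≡ c * Σ< n f
  Σ<-*ˡ zero    c f = sym (ℚP.*-zeroʳ c)
  Σ<-*ˡ (suc n) c f = trans (cong (_+ (c * f n)) (Σ<-*ˡ n c f)) (sym (ℚP.*-distribˡ-+ c (Σ< n f) (f n)))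

  inv-inverseʳ : ∀ x → x ≢ 0ℚ → x * inv x ≡ 1ℚ
  inv-inverseʳ x@(mkℚ (+ zero) _ _) x≢0 = ⊥-elim (x≢0 (ℚP.↥p≡0⇒p≡0 x refl))
  inv-inverseʳ x@(mkℚ +[1+ n ] _ _) x≢0 with x ℚP.≟ 0ℚ
  ... | yes x≡0 = ⊥-elim (x≢0 x≡0)
  ... | no  _   = ℚP.*-inverseʳ x
  inv-inverseʳ x@(mkℚ -[1+ n ] _ _) x≢0 with x ℚP.≟ 0ℚ
  ... | yes x≡0 = ⊥-elim (x≢0 x≡0)
  ... | no  _   = ℚP.*-inverseʳ x

  inv-unique : ∀ x y → x ≢ 0ℚ → x * y ≡ 1ℚ → inv x ≡ y
  inv-unique x y x≢0 xy≡1 = begin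
    inv x             ≡⟨ ℚP.*-identityʳ (inv x) ⟨
    inv x * 1ℚ        ≡⟨ cong (inv x *_) xy≡1 ⟨
    inv x * (x * y)   ≡⟨ ℚP.*-assoc (inv x) x y ⟨
    (inv x * x) * y   ≡⟨ cong (_* y) (trans (ℚP.*-comm (inv x) x) (inv-inverseʳ x x≢0)) ⟩
    1ℚ * y            ≡⟨ ℚP.*-identityˡ y ⟩
    y                 ∎
    where open ≡-Reasoning

  -- p-adic criterion: if B·w = A with integers A, B, p ∤ B and p ∣ A, then w ∈ pℤₚ.
  -- (Writing w = u/d in lowest terms, |B|·|u| = |A|·d; p divides u by Euclid, and
  -- d divides B, so p ∤ d.)
  p-adic-criterion : ∀ p → Prime p → ∀ A B (w : ℚ) → ℤtoℚ B * w ≡ ℤtoℚ A →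
                     ¬ (+ p DS.∣ B) → + p DS.∣ A → InPℤp p w
  p-adic-criterion p p-prime A B w@(mkℚ u d-1 u⊥d) Bw≡A p∤B p∣A = p∣u , p∤d
    where
    d = suc d-1
    cross : (B ℤ.* u) ℤ.* + 1 ≡ A ℤ.* + suc (d-1 ℕ.+ 0)
    cross with ℚP./-injective-≃ (ℚᵘ.mkℚᵘ (B ℤ.* u) (d-1 ℕ.+ 0)) (ℚᵘ.mkℚᵘ A 0)
                 (trans (cong (_* w) (sym (ℤtoℚ≡normal B))) Bw≡A)
    ... | ℚᵘ.*≡* eq = eq
    cross-abs : ℤ.∣ B ∣ ℕ.* ℤ.∣ u ∣ ≡ ℤ.∣ A ∣ ℕ.* d
    cross-abs = begin
      ℤ.∣ B ∣ ℕ.* ℤ.∣ u ∣                ≡⟨ ℤP.abs-* B u ⟨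
      ℤ.∣ B ℤ.* u ∣                      ≡⟨ cong ℤ.∣_∣ (ℤP.*-identityʳ (B ℤ.* u)) ⟨
      ℤ.∣ (B ℤ.* u) ℤ.* + 1 ∣            ≡⟨ cong ℤ.∣_∣ cross ⟩
      ℤ.∣ A ℤ.* + suc (d-1 ℕ.+ 0) ∣      ≡⟨ ℤP.abs-* A (+ suc (d-1 ℕ.+ 0)) ⟩
      ℤ.∣ A ∣ ℕ.* suc (d-1 ℕ.+ 0)        ≡⟨ cong (λ z → ℤ.∣ A ∣ ℕ.* suc z) (ℕP.+-identityʳ d-1) ⟩
      ℤ.∣ A ∣ ℕ.* d                      ∎
      where open ≡-Reasoning
    p∣u : p ℕD.∣ ℤ.∣ u ∣
    p∣u with euclidsLemma ℤ.∣ B ∣ ℤ.∣ u ∣ p-prime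
               (subst (p ℕD.∣_) (sym cross-abs) (ℕD.∣-trans (∣⇒∣ᵤ p∣A) (ℕD.m∣m*n d)))
    ... | inj₁ p∣B = ⊥-elim (p∤B (∣ᵤ⇒∣ p∣B))
    ... | inj₂ p∣u = p∣u
    d∣B : d ℕD.∣ ℤ.∣ B ∣
    d∣B = Coprime.coprime-divisor (Coprime.sym (Coprime.recompute u⊥d))
            (subst (d ℕD.∣_) (trans (ℕP.*-comm d ℤ.∣ A ∣) (trans (sym cross-abs) (ℕP.*-comm ℤ.∣ B ∣ ℤ.∣ u ∣)))
                   (ℕD.m∣m*n ℤ.∣ A ∣))
    p∤d : ¬ (p ℕD.∣ d)
    p∤d p∣d = p∤B (∣ᵤ⇒∣ (ℕD.∣-trans p∣d d∣B))

  intPoly-integral : ∀ cs l → intPoly cs l ≡ ℤtoℚ (coeffℤ cs l)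
  intPoly-integral []       l       = refl
  intPoly-integral (c ∷ cs) zero    = refl
  intPoly-integral (c ∷ cs) (suc l) = intPoly-integral cs l

  𝓕-integral : ∀ N r s c → 𝓕 N r s c ≡ ℤtoℚ (𝓕-coeff N r s c)
  𝓕-integral N r s c with c ≤ᵇ N in c≤ᵇN
  ... | true  = refl
  ... | false = cong (λ z → ℤtoℚ (+ (z ℕ.* (c ℕ.+ s) !))) (sym (stirling-vanishes r N c N<c))
    where N<c : N ℕ.< c
          N<c = ℕP.≰⇒> (λ c≤N → subst T c≤ᵇN (ℕP.≤⇒≤ᵇ c≤N))

  constP-integral : ∀ s c → constP (ℕtoℚ (s !)) c ≡ ℤtoℚ (const-coeff s c)
  constP-integral s zero    = refl
  constP-integral s (suc c) = refl

  𝓡-integral : ∀ a N t r s j → 𝓡 a N t r s j ≡ ℤtoℚ (𝓡-coeff a N t r s j)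
  𝓡-integral a N t r s j =
    trans (Σ<-cong′ (suc t) (λ i →
            trans (Σ<-cong′ (suc j) (λ l →
                    trans (cong₂ ℚ._*_ (intPoly-integral (a i) l) (𝓕-integral (N ℕ.+ i) r s (j ∸ l)))
                          (sym (ℤtoℚ-* (coeffℤ (a i) l) (𝓕-coeff (N ℕ.+ i) r s (j ∸ l))))))
                  (ℤtoℚ-sum (suc j) _)))
          (ℤtoℚ-sum (suc t) _)

  𝓛-integral : ∀ a t y l → 𝓛 a t (ℤtoℚ y) l ≡ ℤtoℚ (𝓛-coeff a t y l)
  𝓛-integral a t y l =
    trans (Σ<-cong′ (suc t) (λ i → trans (cong₂ ℚ._*_ (ℤtoℚ-^ y i) (intPoly-integral (a i) l))
                                         (sym (ℤtoℚ-* (y ℤ.^ i) (coeffℤ (a i) l)))))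
          (ℤtoℚ-sum (suc t) _)

  module Main (q : ℕ) (prime : Prime (suc (suc q))) (m : ℕ) where
    open ModPrime q prime
    open CoefficientCongruence q prime m

    B : ℤ
    B = b ^ suc q

    coprime-nonzero : ∀ x → ¬ (P DS.∣ x) → ℤtoℚ x ≢ 0ℚ
    coprime-nonzero x P∤x = ℤtoℚ-nonzero x (λ { refl → P∤x (DS.divides 0ℤ refl) })

    module _ (P∤b : ¬ (P DS.∣ b)) where

      inv-power : ∀ k → k ℕ.≤ q → inv (ℤtoℚ b ^ℚ suc k) ≡ ℤtoℚ (b ^ (q ∸ k)) ℚ.* inv (ℤtoℚ B)
      inv-power k k≤q = inv-unique (ℤtoℚ b ^ℚ suc k) _ b^k+1≢0 (begin
        ℤtoℚ b ^ℚ suc k ℚ.* (ℤtoℚ (b ^ (q ∸ k)) ℚ.* inv (ℤtoℚ B))   ≡⟨ ℚP.*-assoc (ℤtoℚ b ^ℚ suc k) _ _ ⟨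
        (ℤtoℚ b ^ℚ suc k ℚ.* ℤtoℚ (b ^ (q ∸ k))) ℚ.* inv (ℤtoℚ B)   ≡⟨ cong (ℚ._* inv (ℤtoℚ B)) powers-combine ⟩
        ℤtoℚ B ℚ.* inv (ℤtoℚ B)                                    ≡⟨ inv-inverseʳ (ℤtoℚ B) (coprime-nonzero B (power-coprime b (suc q) P∤b)) ⟩
        1ℚ                                                        ∎)
        where
        open ≡-Reasoning
        b^k+1≢0 : ℤtoℚ b ^ℚ suc k ≢ 0ℚ
        b^k+1≢0 = subst (_≢ 0ℚ) (sym (ℤtoℚ-^ b (suc k))) (coprime-nonzero _ (power-coprime b (suc k) P∤b))
        powers-combine : ℤtoℚ b ^ℚ suc k ℚ.* ℤtoℚ (b ^ (q ∸ k)) ≡ ℤtoℚ B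
        powers-combine = begin
          ℤtoℚ b ^ℚ suc k ℚ.* ℤtoℚ (b ^ (q ∸ k))   ≡⟨ cong (ℚ._* ℤtoℚ (b ^ (q ∸ k))) (ℤtoℚ-^ b (suc k)) ⟩
          ℤtoℚ (b ^ suc k) ℚ.* ℤtoℚ (b ^ (q ∸ k))  ≡⟨ ℤtoℚ-* (b ^ suc k) (b ^ (q ∸ k)) ⟨
          ℤtoℚ (b ^ suc k ℤ.* b ^ (q ∸ k))         ≡⟨ cong ℤtoℚ (ℤP.^-distribˡ-+-* b (suc k) (q ∸ k)) ⟨
          ℤtoℚ (b ^ (suc k ℕ.+ (q ∸ k)))           ≡⟨ cong (λ e → ℤtoℚ (b ^ suc e)) (ℕP.m+[n∸m]≡n k≤q) ⟩
          ℤtoℚ B                                   ∎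

      lhs-coefficient : ∀ a t n r s j →
        ΣP< (suc q) (λ k → inv (ℤtoℚ b ^ℚ suc k) · 𝓡 a (n ℕ.+ suc k) t r s) j
          ≡ inv (ℤtoℚ B) ℚ.* ℤtoℚ (sumℤ (suc q) (λ k → b ^ (q ∸ k) ℤ.* 𝓡-coeff a (n ℕ.+ suc k) t r s j))
      lhs-coefficient a t n r s j = begin
        Σ< (suc q) (λ k → inv (ℤtoℚ b ^ℚ suc k) ℚ.* 𝓡 a (n ℕ.+ suc k) t r s j)
          ≡⟨ Σ<-cong (suc q) (λ k k<1+q → each-term k (ℕP.≤-pred k<1+q)) ⟩
        Σ< (suc q) (λ k → inv (ℤtoℚ B) ℚ.* ℤtoℚ (X k))
          ≡⟨ Σ<-*ˡ (suc q) (inv (ℤtoℚ B)) (λ k → ℤtoℚ (X k)) ⟩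
        inv (ℤtoℚ B) ℚ.* Σ< (suc q) (λ k → ℤtoℚ (X k))
          ≡⟨ cong (inv (ℤtoℚ B) ℚ.*_) (ℤtoℚ-sum (suc q) X) ⟩
        inv (ℤtoℚ B) ℚ.* ℤtoℚ (sumℤ (suc q) X) ∎
        where
        open ≡-Reasoning
        X : ℕ → ℤ
        X k = b ^ (q ∸ k) ℤ.* 𝓡-coeff a (n ℕ.+ suc k) t r s j
        each-term : ∀ k → k ℕ.≤ q → inv (ℤtoℚ b ^ℚ suc k) ℚ.* 𝓡 a (n ℕ.+ suc k) t r s j ≡ inv (ℤtoℚ B) ℚ.* ℤtoℚ (X k)
        each-term k k≤q = begin
          inv (ℤtoℚ b ^ℚ suc k) ℚ.* 𝓡 a (n ℕ.+ suc k) t r s j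
            ≡⟨ cong₂ ℚ._*_ (inv-power k k≤q) (𝓡-integral a (n ℕ.+ suc k) t r s j) ⟩
          ℤtoℚ (b ^ (q ∸ k)) ℚ.* inv (ℤtoℚ B) ℚ.* ℤtoℚ R
            ≡⟨ cong (ℚ._* ℤtoℚ R) (ℚP.*-comm (ℤtoℚ (b ^ (q ∸ k))) (inv (ℤtoℚ B))) ⟩
          inv (ℤtoℚ B) ℚ.* ℤtoℚ (b ^ (q ∸ k)) ℚ.* ℤtoℚ R
            ≡⟨ ℚP.*-assoc (inv (ℤtoℚ B)) (ℤtoℚ (b ^ (q ∸ k))) (ℤtoℚ R) ⟩
          inv (ℤtoℚ B) ℚ.* (ℤtoℚ (b ^ (q ∸ k)) ℚ.* ℤtoℚ R)
            ≡⟨ cong (inv (ℤtoℚ B) ℚ.*_) (ℤtoℚ-* (b ^ (q ∸ k)) R) ⟨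
          inv (ℤtoℚ B) ℚ.* ℤtoℚ (X k) ∎
          where R = 𝓡-coeff a (n ℕ.+ suc k) t r s j

    rhs-coefficient : ∀ a t n r s j →
      ((ℤtoℚ b ^ℚ n) · (𝓛 a t (ℤtoℚ b) ⊛ (𝓕 (suc q) (r ℕ.+ m) s ⊖ constP (ℕtoℚ (s !))))) j
        ≡ ℤtoℚ (b ^ n ℤ.* sumℤ (suc j) (λ l → 𝓛-coeff a t b l ℤ.* 𝓖-coeff r s (j ∸ l)))
    rhs-coefficient a t n r s j = begin
      (ℤtoℚ b ^ℚ n) ℚ.* Σ< (suc j) (λ l → 𝓛 a t (ℤtoℚ b) l ℚ.* (𝓕 (suc q) (r ℕ.+ m) s (j ∸ l) ℚ.- constP (ℕtoℚ (s !)) (j ∸ l)))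
        ≡⟨ cong₂ ℚ._*_ (ℤtoℚ-^ b n) (Σ<-cong′ (suc j) each-term) ⟩
      ℤtoℚ (b ^ n) ℚ.* Σ< (suc j) (λ l → ℤtoℚ (Y l))
        ≡⟨ cong (ℤtoℚ (b ^ n) ℚ.*_) (ℤtoℚ-sum (suc j) Y) ⟩
      ℤtoℚ (b ^ n) ℚ.* ℤtoℚ (sumℤ (suc j) Y)
        ≡⟨ ℤtoℚ-* (b ^ n) (sumℤ (suc j) Y) ⟨
      ℤtoℚ (b ^ n ℤ.* sumℤ (suc j) Y) ∎
      where
      open ≡-Reasoning
      Y : ℕ → ℤ
      Y l = 𝓛-coeff a t b l ℤ.* 𝓖-coeff r s (j ∸ l)
      each-term : ∀ l → 𝓛 a t (ℤtoℚ b) l ℚ.* (𝓕 (suc q) (r ℕ.+ m) s (j ∸ l) ℚ.- constP (ℕtoℚ (s !)) (j ∸ l)) ≡ ℤtoℚ (Y l)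
      each-term l = begin
        𝓛 a t (ℤtoℚ b) l ℚ.* (𝓕 (suc q) (r ℕ.+ m) s (j ∸ l) ℚ.- constP (ℕtoℚ (s !)) (j ∸ l))
          ≡⟨ cong₂ ℚ._*_ (𝓛-integral a t b l) (cong₂ ℚ._-_ (𝓕-integral (suc q) (r ℕ.+ m) s (j ∸ l)) (constP-integral s (j ∸ l))) ⟩
        ℤtoℚ (𝓛-coeff a t b l) ℚ.* (ℤtoℚ (𝓕-coeff (suc q) (r ℕ.+ m) s (j ∸ l)) ℚ.- ℤtoℚ (const-coeff s (j ∸ l)))
          ≡⟨ cong (ℤtoℚ (𝓛-coeff a t b l) ℚ.*_) (ℤtoℚ-- (𝓕-coeff (suc q) (r ℕ.+ m) s (j ∸ l)) (const-coeff s (j ∸ l))) ⟨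
        ℤtoℚ (𝓛-coeff a t b l) ℚ.* ℤtoℚ (𝓖-coeff r s (j ∸ l))
          ≡⟨ ℤtoℚ-* (𝓛-coeff a t b l) (𝓖-coeff r s (j ∸ l)) ⟨
        ℤtoℚ (Y l) ∎

    clear-denominator : ∀ X Y → ℤtoℚ B ≢ 0ℚ →
      ℤtoℚ B ℚ.* (inv (ℤtoℚ B) ℚ.* ℤtoℚ X ℚ.- ℤtoℚ Y) ≡ ℤtoℚ (X ℤ.- B ℤ.* Y)
    clear-denominator X Y D≢0 = begin
      D ℚ.* (inv D ℚ.* ℤtoℚ X ℚ.- ℤtoℚ Y)          ≡⟨ distribute D (inv D) (ℤtoℚ X) (ℤtoℚ Y) ⟩
      (D ℚ.* inv D) ℚ.* ℤtoℚ X ℚ.- D ℚ.* ℤtoℚ Y    ≡⟨ cong (λ z → z ℚ.* ℤtoℚ X ℚ.- D ℚ.* ℤtoℚ Y) (inv-inverseʳ D D≢0) ⟩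
      1ℚ ℚ.* ℤtoℚ X ℚ.- D ℚ.* ℤtoℚ Y               ≡⟨ cong₂ ℚ._-_ (ℚP.*-identityˡ (ℤtoℚ X)) (sym (ℤtoℚ-* B Y)) ⟩
      ℤtoℚ X ℚ.- ℤtoℚ (B ℤ.* Y)                    ≡⟨ ℤtoℚ-- X (B ℤ.* Y) ⟨
      ℤtoℚ (X ℤ.- B ℤ.* Y)                         ∎
      where
      open ≡-Reasoning
      D = ℤtoℚ B
      distribute : ∀ u v x y → u ℚ.* (v ℚ.* x ℚ.- y) ≡ (u ℚ.* v) ℚ.* x ℚ.- u ℚ.* y
      distribute = +-*-Solver.solve 4 (λ u v x y → u :* (v :* x :- y) := u :* v :* x :- u :* y) refl
        where open +-*-Solver

    theorem : ∀ t a n r s → ¬ (p ℕD.∣ m) →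
      ΣP< (suc q) (λ k → inv (ℤtoℚ b ^ℚ suc k) · 𝓡 a (n ℕ.+ suc k) t r s)
        ≡ (ℤtoℚ b ^ℚ n) · (𝓛 a t (ℤtoℚ b) ⊛ (𝓕 (suc q) (r ℕ.+ m) s ⊖ constP (ℕtoℚ (s !))))
        [modpℤp p ]
    theorem t a n r s p∤m j =
      subst (InPℤp p) (sym (cong₂ ℚ._-_ (lhs-coefficient P∤b a t n r s j) (rhs-coefficient a t n r s j)))
            (p-adic-criterion p prime (X ℤ.- B ℤ.* Y) B _ (clear-denominator X Y B≢0) P∤B
                              (divides-difference (main-congruence P∤b a t n r s j)))
      where
      P∤b = coprime-neg p∤m
      P∤B = power-coprime b (suc q) P∤b
      B≢0 = coprime-nonzero B P∤B
      X = sumℤ (suc q) (λ k → b ^ (q ∸ k) ℤ.* 𝓡-coeff a (n ℕ.+ suc k) t r s j)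
      Y = b ^ n ℤ.* sumℤ (suc j) (λ l → 𝓛-coeff a t b l ℤ.* 𝓖-coeff r s (j ∸ l))

open OverRationals

open import Data.Nat using (ℕ; suc; _+_; _∸_)
open import Data.Nat.Divisibility using (_∣_)
open import Data.Integer using (ℤ; -_; +_)

corollary16 : (t : ℕ) (a : ℕ → List ℤ) (n m r s p : ℕ) → Prime p → ¬ (p ∣ m) →
    ΣP< (p ∸ 1) (λ k → inv (ℤtoℚ (- (+ m)) ^ℚ suc k) · 𝓡 a (n + suc k) t r s)
      ≡ (ℤtoℚ (- (+ m)) ^ℚ n) · (𝓛 a t (ℤtoℚ (- (+ m))) ⊛ (𝓕 (p ∸ 1) (r + m) s ⊖ constP (ℕtoℚ (s !))))
      [modpℤp p ]
corollary16 t a n m r s zero          p-prime = ⊥-elim (¬prime[0] p-prime)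
corollary16 t a n m r s (suc zero)    p-prime = ⊥-elim (¬prime[1] p-prime)
corollary16 t a n m r s (suc (suc q)) p-prime = Main.theorem q p-prime m t a n r s
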